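{- For every DAG $G$ the following are equivalent: (1) $G$ has the global lca-property; (2) $\mathrm{lxt}(G)$ has the global lca-property; (3) $\mathrm{lxt}(G)$ has the global pairwise-lca-property; (4) $\mathrm{lxt}(G)$ has the lca-property; (5) $\mathrm{lxt}(G)$ has the pairwise-lca-property; (6) $\mathfrak{C}_{\mathrm{lxt}(G)}$ is a closed clustering system; (7) $\mathfrak{C}_{\mathrm{lxt}(G)}$ is a pre-binary clustering system.
   Context: A DAG is a finite directed graph without loops and directed cycles; $u\preceq_G v$ means there is a directed path from $v$ to $u$ (including $u=v$). $L(G)$ is the set of $\preceq_G$-minimal vertices (leaves); inner vertices are those not in $L(G)$. For non-empty $A\subseteq V(G)$, $\mathrm{LCA}_G(A)$ is the set of $\preceq_G$-minimal vertices $v$ with $a\preceq_G v$ for all $a\in A$. $G$ has: the global lca-property if $|\mathrm{LCA}_G(A)|=1$ for all non-empty $A\subseteq V(G)$; the global pairwise-lca-property if this holds for all $A\subseteq V(G)$ with $|A|=2$; the lca-property if this holds for all non-empty $A\subseteq L(G)$; the pairwise-lca-property if this holds for all $A\subseteq L(G)$ with $|A|=2$. The cluster of $v$ is $C_G(v)=\{x\in L(G): x\preceq_G v\}$ and $\mathfrak{C}_G=\{C_G(v):v\in V(G)\}$. A set system on $X$ is a subset of $2^X$; it is a clustering system if it contains $X$, contains $\{x\}$ for all $x\in X$, and does not contain $\emptyset$. A set system $\mathfrak{C}$ is closed if $A,B\in\mathfrak{C}$ implies $A\cap B\in\mathfrak{C}$ or $A\cap B=\emptyset$. A clustering system $\mathfrak{C}$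 on $X$ is pre-binary if for all $x,y\in X$ there is a unique inclusion-minimal $C\in\mathfrak{C}$ containing $x$ and $y$. The leaf-extended DAG $\mathrm{lxt}(G)$ is obtained from $G$ by adding, for every inner vertex $v$ of $G$, a new vertex $x_v$ and the edge $(v,x_v)$. -}

module Defs where

open import Data.Nat using (ℕ; suc)
open import Data.Fin using (Fin)
open import Data.Bool using (Bool; T)
open import Data.List using (allFin)
open import Data.Bool.ListAction using (any)
open import Data.Product using (Σ; ∃; _×_; _,_)
open import Data.Sum using (_⊎_; inj₁; inj₂)
open import Data.Empty using (⊥)
open import Data.Unit using (⊤)
open import Relation.Nullary using (¬_)
open import Relation.Binary.PropositionalEquality using (_≡_)
open import Relation.Binary.Construct.Closure.ReflexiveTransitive using (Star)
open import Function.Bundles using (_⇔_)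

module GraphNotions {V : Set} (_⇒_ : V → V → Set) where

  _⪯_ : V → V → Set
  u ⪯ v = Star _⇒_ v u

  Acyclic : Set
  Acyclic = ∀ u v → u ⇒ v → u ⪯ v → ⊥

  Leaf : V → Set
  Leaf v = ∀ w → w ⪯ v → w ≡ v

  _∈_ : V → (V → Bool) → Set
  v ∈ A = T (A v)

  NonEmpty : (V → Bool) → Set
  NonEmpty A = ∃ λ a → a ∈ A

  IsLCA : (V → Set) → V → Set
  IsLCA A v = (∀ a → A a → a ⪯ v)
            × (∀ w → (∀ a → A a → a ⪯ w) → w ⪯ v → w ≡ v)

  UniqueLCA : (V → Set) → Set
  UniqueLCA A = Σ V λ v → IsLCA A v × (∀ w → IsLCA A w → w ≡ v)

  Pair : V → V → V → Set
  Pair x y z = z ≡ x ⊎ z ≡ y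

  GlobalLCAProperty : Set
  GlobalLCAProperty = ∀ (A : V → Bool) → NonEmpty A → UniqueLCA (_∈ A)

  GlobalPairwiseLCAProperty : Set
  GlobalPairwiseLCAProperty = ∀ x y → ¬ (x ≡ y) → UniqueLCA (Pair x y)

  LCAProperty : Set
  LCAProperty = ∀ (A : V → Bool) → (∀ a → a ∈ A → Leaf a) → NonEmpty A
              → UniqueLCA (_∈ A)

  PairwiseLCAProperty : Set
  PairwiseLCAProperty = ∀ x y → Leaf x → Leaf y → ¬ (x ≡ y)
                      → UniqueLCA (Pair x y)

  -- Clusters. Subsets of X = L(G) are represented by predicates on V,
  -- only their restriction to leaves matters; equality of subsets of X
  -- is extensional equality on leaves.

  Cluster : V → V → Set
  Cluster v x = x ⪯ v

  _⊆X_ : (V → Set) → (V → Set) → Set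
  S ⊆X T = ∀ x → Leaf x → S x → T x

  _≐X_ : (V → Set) → (V → Set) → Set
  S ≐X T = ∀ x → Leaf x → (S x ⇔ T x)

  InClusters : (V → Set) → Set
  InClusters S = ∃ λ v → Cluster v ≐X S

  IsClusteringSystem : Set
  IsClusteringSystem =
      InClusters (λ _ → ⊤)
    × (∀ x → Leaf x → InClusters (λ y → y ≡ x))
    × ¬ InClusters (λ _ → ⊥)

  _∩_ : (V → Set) → (V → Set) → V → Set
  (S ∩ T) x = S x × T x

  -- 𝔠_G is closed (members of 𝔠_G are exactly the C_G(u), u ∈ V)
  IsClosed : Set
  IsClosed = ∀ u v → InClusters (Cluster u ∩ Cluster v)
                   ⊎ (Cluster u ∩ Cluster v) ≐X (λ _ → ⊥)

  MinimalContaining : V → V → V → Set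
  MinimalContaining x y v =
      Cluster v x × Cluster v y
    × (∀ w → Cluster w x → Cluster w y → Cluster w ⊆X Cluster v
         → Cluster w ≐X Cluster v)

  IsPreBinary : Set
  IsPreBinary = IsClusteringSystem
    × (∀ x y → Leaf x → Leaf y →
         Σ V λ v → MinimalContaining x y v
           × (∀ w → MinimalContaining x y w → Cluster w ≐X Cluster v))

module FinGraph {n : ℕ} (E : Fin n → Fin n → Bool) where

  Edge : Fin n → Fin n → Set
  Edge u v = T (E u v)

  isInner : Fin n → Bool
  isInner v = any (E v) (allFin n)

  -- vertices of lxt(G): old vertices and a new x_v for each inner v
  LxtV : Set
  LxtV = Fin n ⊎ Σ (Fin n) (λ v → T (isInner v))

  LxtEdge : LxtV → LxtV → Set
  LxtEdge (inj₁ u) (inj₁ v) = T (E u v)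
  LxtEdge (inj₁ u) (inj₂ (v , _)) = u ≡ v
  LxtEdge (inj₂ _) _ = ⊥

{-# OPTIONS --safe #-}
module Submission where

-- All seven conditions are equivalent to G having a join (least upper bound) for every pair of
-- vertices. In a finite DAG pairwise joins give joins of all non-empty sets, and a join is the
-- unique LCA; conversely, if {x, y} has a unique LCA then every upper bound lies above a minimal
-- one, which is that LCA, so it is a join.
-- In lxt(G) every vertex v of G is represented by a leaf ℓ(v) (x_v, or v itself if v is a leaf)
-- with ℓ(v) ⪯ w iff v ⪯ w for the old vertices w. Hence the unique LCA of ℓ(a) and ℓ(b) in lxt(G)
-- is the join of a and b in G, and joins of G lift to lxt(G). The same leaves make every vertex
-- above two distinct leaves x, y determined by its cluster, so the inclusion-minimal clusters
-- containing x and y are the clusters of the LCAs of x and y, and in a closed system two such LCAs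
-- u, v both equal the vertex whose cluster is C(u) ∩ C(v).

open import Defs
open import Data.Nat using (ℕ; suc)
open import Data.Fin using (Fin; zero; _≟_)
open import Data.Fin.Properties using (any?)
open import Data.Fin.Induction using (spo-wellFounded)
open import Data.Bool using (Bool; T; _∨_)
open import Data.Bool.Properties using (T-irrelevant)
open import Data.Product using (_×_; Σ; ∃; _,_; proj₁; proj₂; uncurry)
open import Data.Product.Properties using () renaming (≡-dec to Σ-≡-dec)
open import Data.Sum using (_⊎_; inj₁; inj₂)
open import Data.Sum.Properties using () renaming (≡-dec to ⊎-≡-dec)
open import Data.Empty using (⊥; ⊥-elim)
open import Data.Unit using (tt)
open import Data.List using (List; []; _∷_; [_]; allFin; map; _++_; concatMap; filter)
open import Data.List.Membership.Propositional using (lose) renaming (_∈_ to _∈ˡ_)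
open import Data.List.Membership.Propositional.Properties
  using (∈-allFin; ∈-map⁺; ∈-++⁺ˡ; ∈-++⁺ʳ; ∈-concatMap⁺; ∈-filter⁺; ∈-filter⁻)
open import Data.List.Relation.Unary.Any using (here; there)
open import Data.List.Relation.Unary.Any.Properties using (any⁺)
open import Relation.Nullary using (¬_; Dec; yes; no; ⌊_⌋; _×-dec_; map′)
open import Relation.Nullary.Decidable using (T?)
open import Relation.Binary.Definitions using (DecidableEquality)
open import Relation.Binary.Structures using (IsStrictPartialOrder)
open import Relation.Binary.PropositionalEquality using (_≡_; refl; sym; trans; cong; subst; isEquivalence)
open import Relation.Binary.Construct.Closure.ReflexiveTransitive
  using (Star; ε; _◅_; _◅◅_; gmap; kleisliStar)
open import Induction.WellFounded using (Acc; acc)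
open import Function using (_∘_; id; case_of_)
open import Function.Bundles using (_⇔_; mk⇔; Equivalence)
open import Function.Construct.Symmetry using (⇔-sym)

open Equivalence using (to; from)

module FiniteDAG {V : Set} (_⇒_ : V → V → Set)
                 (vertices : List V) (∈-vertices : ∀ v → v ∈ˡ vertices)
                 (acyclic : GraphNotions.Acyclic _⇒_)
                 (_⪯?_ : ∀ u v → Dec (GraphNotions._⪯_ _⇒_ u v))
                 (_≟V_ : DecidableEquality V) where
  open GraphNotions _⇒_ public

  ⪯-trans : ∀ {u v w} → u ⪯ v → v ⪯ w → u ⪯ w
  ⪯-trans u⪯v v⪯w = v⪯w ◅◅ u⪯v

  ⪯-antisym : ∀ {u v} → u ⪯ v → v ⪯ u → u ≡ v
  ⪯-antisym ε _ = refl
  ⪯-antisym (e ◅ p) q = ⊥-elim (acyclic _ _ e (p ◅◅ q))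

  UpperBound : (V → Set) → V → Set
  UpperBound P w = ∀ a → P a → a ⪯ w

  IsJoin : (V → Set) → V → Set
  IsJoin P j = UpperBound P j × (∀ w → UpperBound P w → j ⪯ w)

  HasPairwiseJoins : Set
  HasPairwiseJoins = ∀ x y → ∃ (IsJoin (Pair x y))

  -- IsLCA A is definitionally Minimal (UpperBound A).
  Minimal : (V → Set) → V → Set
  Minimal P m = P m × (∀ z → P z → z ⪯ m → z ≡ m)

  pair-upperBound : ∀ {x y w} → x ⪯ w → y ⪯ w → UpperBound (Pair x y) w
  pair-upperBound x⪯w _ _ (inj₁ refl) = x⪯w
  pair-upperBound _ y⪯w _ (inj₂ refl) = y⪯w

  upperBound-cong : ∀ {P Q w} → (∀ z → P z ⇔ Q z) → UpperBound P w → UpperBound Q w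
  upperBound-cong P⇔Q ub a qa = ub a (from (P⇔Q a) qa)

  isJoin-cong : ∀ {P Q j} → (∀ z → P z ⇔ Q z) → IsJoin P j → IsJoin Q j
  isJoin-cong P⇔Q (ub , least) =
    upperBound-cong P⇔Q ub , λ w → least w ∘ upperBound-cong (⇔-sym ∘ P⇔Q)

  isLCA-cong : ∀ {P Q v} → (∀ z → P z ⇔ Q z) → IsLCA P v → IsLCA Q v
  isLCA-cong P⇔Q (ub , minimal) =
    upperBound-cong P⇔Q ub , λ w → minimal w ∘ upperBound-cong (⇔-sym ∘ P⇔Q)

  uniqueLCA-cong : ∀ {P Q} → (∀ z → P z ⇔ Q z) → UniqueLCA P → UniqueLCA Q
  uniqueLCA-cong P⇔Q (v , lca , unique) =
    v , isLCA-cong P⇔Q lca , λ w → unique w ∘ isLCA-cong (⇔-sym ∘ P⇔Q)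

  isJoin-refl : ∀ x → IsJoin (Pair x x) x
  isJoin-refl x = pair-upperBound ε ε , λ w ub → ub x (inj₁ refl)

  isJoin⇒uniqueLCA : ∀ {P j} → IsJoin P j → UniqueLCA P
  isJoin⇒uniqueLCA {j = j} (ub , least) =
    j , (ub , λ w ubw w⪯j → ⪯-antisym w⪯j (least w ubw)) ,
    λ w (ubw , minimal) → sym (minimal j ub (least w ubw))

  pairSet : V → V → V → Bool
  pairSet x y z = ⌊ z ≟V x ⌋ ∨ ⌊ z ≟V y ⌋

  ∈-pairSet : ∀ x y z → z ∈ pairSet x y ⇔ Pair x y z
  ∈-pairSet x y z with z ≟V x | z ≟V y
  ... | yes z≡x | _ = mk⇔ (λ _ → inj₁ z≡x) _
  ... | no _ | yes z≡y = mk⇔ (λ _ → inj₂ z≡y) _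
  ... | no z≢x | no z≢y = mk⇔ (λ ()) λ { (inj₁ z≡x) → z≢x z≡x ; (inj₂ z≡y) → z≢y z≡y }

  pairSet-nonEmpty : ∀ x y → NonEmpty (pairSet x y)
  pairSet-nonEmpty x y = x , from (∈-pairSet x y x) (inj₁ refl)

  module _ (joins : HasPairwiseJoins) where

    isJoin-∷ : ∀ {x xs j k} → IsJoin (_∈ˡ xs) j → IsJoin (Pair x j) k → IsJoin (_∈ˡ x ∷ xs) k
    isJoin-∷ {x} {xs} {j} {k} (ub , least) (ubₖ , leastₖ) = ub′ , least′
      where
        ub′ : UpperBound (_∈ˡ x ∷ xs) k
        ub′ a (here refl) = ubₖ a (inj₁ refl)
        ub′ a (there a∈xs) = ⪯-trans (ub a a∈xs) (ubₖ j (inj₂ refl))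
        least′ : ∀ w → UpperBound (_∈ˡ x ∷ xs) w → k ⪯ w
        least′ w ubw = leastₖ w (pair-upperBound (ubw x (here refl)) (least w (λ a → ubw a ∘ there)))

    join-of-list : ∀ x xs → ∃ (IsJoin (_∈ˡ x ∷ xs))
    join-of-list x [] = x , (λ { a (here refl) → ε }) , λ w ubw → ubw x (here refl)
    join-of-list x (y ∷ ys) =
      let j , j-join = join-of-list y ys ; k , k-join = joins x j in k , isJoin-∷ j-join k-join

    empty-or-join : ∀ {P : V → Set} → (∀ v → Dec (P v)) → (∀ v → ¬ P v) ⊎ ∃ (IsJoin P)
    empty-or-join {P} P? = by-cases (filter P? vertices) ∈-filtered
      where
        ∈-filtered : ∀ v → v ∈ˡ filter P? vertices ⇔ P v
        ∈-filtered v = mk⇔ (proj₂ ∘ ∈-filter⁻ P? {xs = vertices}) (∈-filter⁺ P? (∈-vertices v))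
        by-cases : ∀ xs → (∀ v → v ∈ˡ xs ⇔ P v) → (∀ v → ¬ P v) ⊎ ∃ (IsJoin P)
        by-cases [] []⇔P = inj₁ λ v pv → case from ([]⇔P v) pv of λ ()
        by-cases (x ∷ xs) xs⇔P =
          let j , j-join = join-of-list x xs in inj₂ (j , isJoin-cong xs⇔P j-join)

  minimal-below : ∀ {P : V → Set} → (∀ v → Dec (P v)) → ∀ {w} → P w →
                  ∃ λ m → Minimal P m × m ⪯ w
  minimal-below {P} P? pw = let m , pm , m⪯w , minimal = scan vertices pw in
    m , (pm , λ z → minimal z (∈-vertices z)) , m⪯w
    where
      MinimalAmong : List V → V → Set
      MinimalAmong xs m = ∀ z → z ∈ˡ xs → P z → z ⪯ m → z ≡ m

      scan : ∀ xs {w} → P w → ∃ λ m → P m × m ⪯ w × MinimalAmong xs m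
      scan [] {w} pw = w , pw , ε , λ _ ()
      scan (x ∷ xs) {w} pw with P? x ×-dec x ⪯? w
      ... | yes (px , x⪯w) = let m , pm , m⪯x , minimal = scan xs px in
        m , pm , ⪯-trans m⪯x x⪯w , λ where
          z (here refl) _ z⪯m → ⪯-antisym z⪯m m⪯x
          z (there z∈xs) → minimal z z∈xs
      ... | no ¬px×x⪯w = let m , pm , m⪯w , minimal = scan xs pw in
        m , pm , m⪯w , λ where
          z (here refl) pz z⪯m → ⊥-elim (¬px×x⪯w (pz , ⪯-trans z⪯m m⪯w))
          z (there z∈xs) → minimal z z∈xs

  upperBound-pair? : ∀ x y w → Dec (UpperBound (Pair x y) w)
  upperBound-pair? x y w =
    map′ (uncurry pair-upperBound) (λ ub → ub x (inj₁ refl) , ub y (inj₂ refl)) (x ⪯? w ×-dec y ⪯? w)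

  uniqueLCA⇒join : ∀ {x y} → UniqueLCA (Pair x y) → ∃ (IsJoin (Pair x y))
  uniqueLCA⇒join {x} {y} (v , (ub , _) , unique) = v , ub , least
    where
      least : ∀ w → UpperBound (Pair x y) w → v ⪯ w
      least w ubw = let m , m-lca , m⪯w = minimal-below (upperBound-pair? x y) ubw in
        subst (_⪯ w) (unique m m-lca) m⪯w

  leaf-below : ∀ w → ∃ λ m → Leaf m × m ⪯ w
  leaf-below w = let m , (_ , minimal) , m⪯w = minimal-below (λ _ → yes tt) tt in
    m , (λ z → minimal z tt) , m⪯w

  pairwiseJoins⇒globalLCA : HasPairwiseJoins → GlobalLCAProperty
  pairwiseJoins⇒globalLCA joins A (a , a∈A) with empty-or-join joins (λ v → T? (A v))
  ... | inj₁ empty = ⊥-elim (empty a a∈A)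
  ... | inj₂ (j , j-join) = isJoin⇒uniqueLCA j-join

  pairwiseJoins⇒globalPairwiseLCA : HasPairwiseJoins → GlobalPairwiseLCAProperty
  pairwiseJoins⇒globalPairwiseLCA joins x y _ = isJoin⇒uniqueLCA (proj₂ (joins x y))

  globalLCA⇒pairwiseJoins : GlobalLCAProperty → HasPairwiseJoins
  globalLCA⇒pairwiseJoins lca x y =
    uniqueLCA⇒join (uniqueLCA-cong (∈-pairSet x y) (lca (pairSet x y) (pairSet-nonEmpty x y)))

  globalLCA⇒lca : GlobalLCAProperty → LCAProperty
  globalLCA⇒lca lca A _ = lca A

  globalPairwiseLCA⇒pairwiseLCA : GlobalPairwiseLCAProperty → PairwiseLCAProperty
  globalPairwiseLCA⇒pairwiseLCA lca x y _ _ = lca x y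

  pair-leaf : ∀ {x y a} → Leaf x → Leaf y → Pair x y a → Leaf a
  pair-leaf x-leaf _ (inj₁ refl) = x-leaf
  pair-leaf _ y-leaf (inj₂ refl) = y-leaf

  lca⇒pairwiseLCA : LCAProperty → PairwiseLCAProperty
  lca⇒pairwiseLCA lca x y x-leaf y-leaf _ =
    uniqueLCA-cong (∈-pairSet x y) (lca (pairSet x y) leaves (pairSet-nonEmpty x y))
    where
      leaves : ∀ a → a ∈ pairSet x y → Leaf a
      leaves a = pair-leaf x-leaf y-leaf ∘ to (∈-pairSet x y a)

  leaf-cluster : ∀ {x} → Leaf x → InClusters (_≡ x)
  leaf-cluster x-leaf = _ , λ y _ → mk⇔ (x-leaf y) λ { refl → ε }

  pairwiseJoins⇒clusteringSystem : V → HasPairwiseJoins → IsClusteringSystem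
  pairwiseJoins⇒clusteringSystem v joins with empty-or-join joins (λ _ → yes tt)
  ... | inj₁ empty = ⊥-elim (empty v tt)
  ... | inj₂ (r , ub , _) =
    (r , λ x _ → mk⇔ _ (λ _ → ub x tt)) , (λ _ → leaf-cluster) , no-empty-cluster
    where
      no-empty-cluster : ¬ InClusters (λ _ → ⊥)
      no-empty-cluster (w , Cw≐∅) = let m , m-leaf , m⪯w = leaf-below w in to (Cw≐∅ m m-leaf) m⪯w

  pairwiseJoins⇒closed : HasPairwiseJoins → IsClosed
  pairwiseJoins⇒closed joins u v with empty-or-join joins (λ z → z ⪯? u ×-dec z ⪯? v)
  ... | inj₁ empty = inj₂ λ x _ → mk⇔ (empty x) ⊥-elim
  ... | inj₂ (j , ub , least) =
    inj₁ (j , λ x _ → mk⇔ (λ x⪯j → ⪯-trans x⪯j j⪯u , ⪯-trans x⪯j j⪯v) (ub x))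
    where
      j⪯u : j ⪯ u
      j⪯u = least u λ _ → proj₁
      j⪯v : j ⪯ v
      j⪯v = least v λ _ → proj₂

  pairwiseJoins⇒closedClusteringSystem : V → HasPairwiseJoins → IsClusteringSystem × IsClosed
  pairwiseJoins⇒closedClusteringSystem v joins =
    pairwiseJoins⇒clusteringSystem v joins , pairwiseJoins⇒closed joins

  isJoin⇒minimalContaining : ∀ {x y j} → IsJoin (Pair x y) j → MinimalContaining x y j
  isJoin⇒minimalContaining (ub , least) =
    ub _ (inj₁ refl) , ub _ (inj₂ refl) , λ w x⪯w y⪯w Cw⊆Cj z z-leaf →
    mk⇔ (Cw⊆Cj z z-leaf) (λ z⪯j → ⪯-trans z⪯j (least w (pair-upperBound x⪯w y⪯w)))

  minimalContaining-≐-join : ∀ {x y j w} → IsJoin (Pair x y) j → MinimalContaining x y w →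
                             Cluster w ≐X Cluster j
  minimalContaining-≐-join {j = j} {w} (ub , least) (x⪯w , y⪯w , minimal) z z-leaf =
    ⇔-sym (minimal j (ub _ (inj₁ refl)) (ub _ (inj₂ refl)) Cj⊆Cw z z-leaf)
    where
      Cj⊆Cw : Cluster j ⊆X Cluster w
      Cj⊆Cw a _ a⪯j = ⪯-trans a⪯j (least w (pair-upperBound x⪯w y⪯w))

  pairwiseJoins⇒preBinary : V → HasPairwiseJoins → IsPreBinary
  pairwiseJoins⇒preBinary v joins = pairwiseJoins⇒clusteringSystem v joins , λ x y _ _ →
    let j , j-join = joins x y in
    j , isJoin⇒minimalContaining j-join , λ w → minimalContaining-≐-join j-join

  ClustersFaithfulAbove : V → V → Set
  ClustersFaithfulAbove x y = ∀ {u v} → UpperBound (Pair x y) u → Cluster u ⊆X Cluster v → u ⪯ v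

  ClustersFaithful : Set
  ClustersFaithful = ∀ x y → Leaf x → Leaf y → ¬ x ≡ y → ClustersFaithfulAbove x y

  module _ {x y} (faithful : ClustersFaithfulAbove x y) where

    cluster-injective : ∀ {u v} → UpperBound (Pair x y) u → UpperBound (Pair x y) v →
                        Cluster u ≐X Cluster v → u ≡ v
    cluster-injective ubu ubv Cu≐Cv =
      ⪯-antisym (faithful ubu λ z z-leaf → to (Cu≐Cv z z-leaf))
                (faithful ubv λ z z-leaf → from (Cu≐Cv z z-leaf))

    minimalContaining⇒isLCA : ∀ {v} → MinimalContaining x y v → IsLCA (Pair x y) v
    minimalContaining⇒isLCA (x⪯v , y⪯v , minimal) = pair-upperBound x⪯v y⪯v , λ w ubw w⪯v →
      cluster-injective ubw (pair-upperBound x⪯v y⪯v)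
        (minimal w (ubw x (inj₁ refl)) (ubw y (inj₂ refl)) λ z _ z⪯w → ⪯-trans z⪯w w⪯v)

    isLCA⇒minimalContaining : ∀ {v} → IsLCA (Pair x y) v → MinimalContaining x y v
    isLCA⇒minimalContaining (ub , minimal) =
      ub x (inj₁ refl) , ub y (inj₂ refl) , λ w x⪯w y⪯w Cw⊆Cv z z-leaf →
      let ubw = pair-upperBound x⪯w y⪯w in
      mk⇔ (Cw⊆Cv z z-leaf) (subst (z ⪯_) (sym (minimal w ubw (faithful ubw Cw⊆Cv))))

  preBinary⇒pairwiseLCA : ClustersFaithful → IsPreBinary → PairwiseLCAProperty
  preBinary⇒pairwiseLCA faithful (_ , preBinary) x y x-leaf y-leaf x≢y with preBinary x y x-leaf y-leaf
  ... | v , v-minimal , unique = v , v-lca , λ w w-lca →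
    cluster-injective F (proj₁ w-lca) (proj₁ v-lca) (unique w (isLCA⇒minimalContaining F w-lca))
    where
      F : ClustersFaithfulAbove x y
      F = faithful x y x-leaf y-leaf x≢y
      v-lca : IsLCA (Pair x y) v
      v-lca = minimalContaining⇒isLCA F v-minimal

  closed⇒pairwiseLCA : ClustersFaithful → IsClusteringSystem → IsClosed → PairwiseLCAProperty
  closed⇒pairwiseLCA faithful ((r , Cr≐X) , _) closed x y x-leaf y-leaf x≢y =
    let m , m-lca , _ = minimal-below (upperBound-pair? x y) below-r in
    m , m-lca , λ w w-lca → lcas-equal w-lca m-lca
    where
      F : ClustersFaithfulAbove x y
      F = faithful x y x-leaf y-leaf x≢y
      below-r : UpperBound (Pair x y) r
      below-r a a∈ = from (Cr≐X a (pair-leaf x-leaf y-leaf a∈)) tt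
      lcas-equal : ∀ {u v} → IsLCA (Pair x y) u → IsLCA (Pair x y) v → u ≡ v
      lcas-equal {u} {v} (ubu , minimalᵤ) (ubv , minimalᵥ) with closed u v
      ... | inj₂ Cu∩Cv≐∅ =
        ⊥-elim (to (Cu∩Cv≐∅ x x-leaf) (ubu x (inj₁ refl) , ubv x (inj₁ refl)))
      ... | inj₁ (z , Cz≐Cu∩Cv) = trans (sym (minimalᵤ z ubz z⪯u)) (minimalᵥ z ubz z⪯v)
        where
          ubz : UpperBound (Pair x y) z
          ubz a a∈ = from (Cz≐Cu∩Cv a (pair-leaf x-leaf y-leaf a∈)) (ubu a a∈ , ubv a a∈)
          z⪯u : z ⪯ u
          z⪯u = F ubz λ a a-leaf → proj₁ ∘ to (Cz≐Cu∩Cv a a-leaf)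
          z⪯v : z ⪯ v
          z⪯v = F ubz λ a a-leaf → proj₂ ∘ to (Cz≐Cu∩Cv a a-leaf)

module Reachability {n : ℕ} (E : Fin n → Fin n → Bool)
                    (acyclic : GraphNotions.Acyclic (FinGraph.Edge E)) where
  open FinGraph E using (Edge)
  open GraphNotions Edge using (_⪯_)

  _≺_ : Fin n → Fin n → Set
  u ≺ v = ∃ λ w → Edge v w × u ⪯ w

  ≺-isStrictPartialOrder : IsStrictPartialOrder _≡_ _≺_
  ≺-isStrictPartialOrder = record
    { isEquivalence = isEquivalence
    ; irrefl = λ { refl (w , e , u⪯w) → acyclic _ w e u⪯w }
    ; trans = λ { (w , e , u⪯w) (w′ , e′ , v⪯w′) → w′ , e′ , (v⪯w′ ◅◅ (e ◅ u⪯w)) }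
    ; <-resp-≈ = (λ { refl u≺v → u≺v }) , (λ { refl u≺v → u≺v })
    }

  _⪯?_ : ∀ u v → Dec (u ⪯ v)
  u ⪯? v = below? (spo-wellFounded ≺-isStrictPartialOrder v)
    where
      below? : ∀ {v} → Acc _≺_ v → Dec (u ⪯ v)
      below? {v} (acc smaller) with v ≟ u | any? step?
        where
          step? : ∀ w → Dec (Edge v w × u ⪯ w)
          step? w with T? (E v w)
          ... | yes e = map′ (e ,_) proj₂ (below? (smaller (w , e , ε)))
          ... | no ¬e = no (¬e ∘ proj₁)
      ... | yes refl | _ = yes ε
      ... | no _ | yes (w , e , u⪯w) = yes (e ◅ u⪯w)
      ... | no v≢u | no no-step = no λ { ε → v≢u refl ; (e ◅ u⪯w) → no-step (_ , e , u⪯w) }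

module LeafExtension {n : ℕ} (E : Fin n → Fin n → Bool)
                     (acyclic : GraphNotions.Acyclic (FinGraph.Edge E)) where
  open FinGraph E
  open GraphNotions Edge using (_⪯_)
  open GraphNotions LxtEdge using () renaming (_⪯_ to _⊑_)
  open Reachability E acyclic using (_⪯?_)

  origin : LxtV → Fin n
  origin (inj₁ v) = v
  origin (inj₂ (v , _)) = v

  origin-mono : ∀ {x y} → x ⊑ y → origin x ⪯ origin y
  origin-mono = kleisliStar origin (λ {x} {y} → edge {x} {y})
    where
      edge : ∀ {x y} → LxtEdge x y → Star Edge (origin x) (origin y)
      edge {inj₁ _} {inj₁ _} e = e ◅ ε
      edge {inj₁ _} {inj₂ _} refl = ε

  inj₁-mono : ∀ {u v} → u ⪯ v → inj₁ u ⊑ inj₁ v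
  inj₁-mono = gmap inj₁ id

  ⊑-inj₁ : ∀ x {v} → origin x ⪯ v → x ⊑ inj₁ v
  ⊑-inj₁ (inj₁ _) u⪯v = inj₁-mono u⪯v
  ⊑-inj₁ (inj₂ _) u⪯v = inj₁-mono u⪯v ◅◅ (refl ◅ ε)

  ⊑-inj₂ : ∀ {x q} → x ⊑ inj₂ q → x ≡ inj₂ q
  ⊑-inj₂ ε = refl
  ⊑-inj₂ (() ◅ _)

  lxt-acyclic : GraphNotions.Acyclic LxtEdge
  lxt-acyclic (inj₁ u) (inj₁ v) e v⊑u = acyclic u v e (origin-mono v⊑u)
  lxt-acyclic (inj₁ u) (inj₂ _) _ v⊑u = case ⊑-inj₂ v⊑u of λ ()

  _≟ˣ_ : DecidableEquality LxtV
  _≟ˣ_ = ⊎-≡-dec _≟_ (Σ-≡-dec _≟_ λ p q → yes (T-irrelevant p q))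

  _⊑?_ : ∀ x y → Dec (x ⊑ y)
  x ⊑? inj₁ v = map′ (⊑-inj₁ x) origin-mono (origin x ⪯? v)
  x ⊑? inj₂ q = map′ (λ { refl → ε }) ⊑-inj₂ (x ≟ˣ inj₂ q)

  InnerVertex : Set
  InnerVertex = Σ (Fin n) (T ∘ isInner)

  newVertexAt : ∀ v → Dec (T (isInner v)) → List InnerVertex
  newVertexAt v (yes inner) = [ v , inner ]
  newVertexAt v (no _) = []

  ∈-newVertexAt : ∀ v inner d → (v , inner) ∈ˡ newVertexAt v d
  ∈-newVertexAt v inner (yes inner′) = here (cong (v ,_) (T-irrelevant inner inner′))
  ∈-newVertexAt v inner (no ¬inner) = ⊥-elim (¬inner inner)

  newVertexOf : Fin n → List InnerVertex
  newVertexOf v = newVertexAt v (T? (isInner v))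

  lxtVertices : List LxtV
  lxtVertices = map inj₁ (allFin n) ++ map inj₂ (concatMap newVertexOf (allFin n))

  ∈-lxtVertices : ∀ x → x ∈ˡ lxtVertices
  ∈-lxtVertices (inj₁ v) = ∈-++⁺ˡ (∈-map⁺ inj₁ (∈-allFin v))
  ∈-lxtVertices (inj₂ (v , inner)) =
    ∈-++⁺ʳ (map inj₁ (allFin n))
           (∈-map⁺ inj₂ (∈-concatMap⁺ newVertexOf (lose (∈-allFin v) (∈-newVertexAt v inner _))))

  module G = FiniteDAG Edge (allFin n) ∈-allFin acyclic _⪯?_ _≟_
  module X = FiniteDAG LxtEdge lxtVertices ∈-lxtVertices lxt-acyclic _⊑?_ _≟ˣ_

  upperBound-of-distinct : ∀ {x y w} → ¬ x ≡ y → X.UpperBound (X.Pair x y) w → ∃ λ v → w ≡ inj₁ v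
  upperBound-of-distinct {w = inj₁ v} _ _ = v , refl
  upperBound-of-distinct {x} {y} {inj₂ _} x≢y ubw =
    ⊥-elim (x≢y (trans (⊑-inj₂ (ubw x (inj₁ refl))) (sym (⊑-inj₂ (ubw y (inj₂ refl))))))

  leafAt : ∀ v → Dec (T (isInner v)) → LxtV
  leafAt v (yes inner) = inj₂ (v , inner)
  leafAt v (no _) = inj₁ v

  leaf : Fin n → LxtV
  leaf v = leafAt v (T? (isInner v))

  edge⇒inner : ∀ {u v} → Edge u v → T (isInner u)
  edge⇒inner {u} {v} e = any⁺ (E u) (lose (∈-allFin v) e)

  leafAt-isLeaf : ∀ v d → X.Leaf (leafAt v d)
  leafAt-isLeaf v (yes _) _ = ⊑-inj₂
  leafAt-isLeaf v (no _) _ ε = refl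
  leafAt-isLeaf v (no ¬inner) _ (_◅_ {j = inj₁ _} e _) = ⊥-elim (¬inner (edge⇒inner e))
  leafAt-isLeaf v (no ¬inner) _ (_◅_ {j = inj₂ (_ , inner)} refl _) = ⊥-elim (¬inner inner)

  leaf-isLeaf : ∀ v → X.Leaf (leaf v)
  leaf-isLeaf v = leafAt-isLeaf v _

  origin-leaf : ∀ v → origin (leaf v) ≡ v
  origin-leaf v with T? (isInner v)
  ... | yes _ = refl
  ... | no _ = refl

  leaf-injective : ∀ {u v} → leaf u ≡ leaf v → u ≡ v
  leaf-injective {u} {v} eq = trans (sym (origin-leaf u)) (trans (cong origin eq) (origin-leaf v))

  leaf-⊑ : ∀ {u v} → u ⪯ v → leaf u ⊑ inj₁ v
  leaf-⊑ {u} u⪯v = ⊑-inj₁ (leaf u) (subst (_⪯ _) (sym (origin-leaf u)) u⪯v)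

  leaf-⊑⇒⪯ : ∀ {u x} → leaf u ⊑ x → u ⪯ origin x
  leaf-⊑⇒⪯ {u} u⊑x = subst (_⪯ _) (origin-leaf u) (origin-mono u⊑x)

  joins⇒lxt-joins : G.HasPairwiseJoins → X.HasPairwiseJoins
  joins⇒lxt-joins joins x y with x ≟ˣ y | joins (origin x) (origin y)
  ... | yes refl | _ = x , X.isJoin-refl x
  ... | no x≢y | j , ub , least =
    inj₁ j , X.pair-upperBound (⊑-inj₁ x (ub _ (inj₁ refl))) (⊑-inj₁ y (ub _ (inj₂ refl))) , least′
    where
      least′ : ∀ w → X.UpperBound (X.Pair x y) w → inj₁ j ⊑ w
      least′ w ubw with upperBound-of-distinct x≢y ubw
      ... | v , refl =
        inj₁-mono (least v (G.pair-upperBound (origin-mono (ubw x (inj₁ refl))) (origin-mono (ubw y (inj₂ refl)))))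

  lxt-join⇒join : ∀ {a b j} → X.IsJoin (X.Pair (leaf a) (leaf b)) j → G.IsJoin (G.Pair a b) (origin j)
  lxt-join⇒join {a} {b} (ub , least) =
    G.pair-upperBound (leaf-⊑⇒⪯ (ub _ (inj₁ refl))) (leaf-⊑⇒⪯ (ub _ (inj₂ refl))) ,
    λ w ubw → origin-mono (least (inj₁ w)
                             (X.pair-upperBound (leaf-⊑ (ubw a (inj₁ refl))) (leaf-⊑ (ubw b (inj₂ refl)))))

  pairwiseLCA⇒joins : X.PairwiseLCAProperty → G.HasPairwiseJoins
  pairwiseLCA⇒joins lca a b with a ≟ b
  ... | yes refl = a , G.isJoin-refl a
  ... | no a≢b =
    let lcaᵃᵇ = lca (leaf a) (leaf b) (leaf-isLeaf a) (leaf-isLeaf b) (a≢b ∘ leaf-injective)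
        j , j-join = X.uniqueLCA⇒join lcaᵃᵇ in
    origin j , lxt-join⇒join j-join

  lxt-clustersFaithful : X.ClustersFaithful
  lxt-clustersFaithful x y x-leaf y-leaf x≢y ubu Cu⊆Cv
    with upperBound-of-distinct x≢y ubu
       | upperBound-of-distinct x≢y (λ a a∈ → Cu⊆Cv a (X.pair-leaf x-leaf y-leaf a∈) (ubu a a∈))
  ... | u , refl | v , refl = inj₁-mono (leaf-⊑⇒⪯ (Cu⊆Cv (leaf u) (leaf-isLeaf u) (leaf-⊑ ε)))

theorem6p7 : (n : ℕ) (E : Fin (suc n) → Fin (suc n) → Bool) →
    GraphNotions.Acyclic (FinGraph.Edge E) →
    (GraphNotions.GlobalLCAProperty (FinGraph.Edge E) ⇔ GraphNotions.GlobalLCAProperty (FinGraph.LxtEdge E))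
    × (GraphNotions.GlobalLCAProperty (FinGraph.Edge E) ⇔ GraphNotions.GlobalPairwiseLCAProperty (FinGraph.LxtEdge E))
    × (GraphNotions.GlobalLCAProperty (FinGraph.Edge E) ⇔ GraphNotions.LCAProperty (FinGraph.LxtEdge E))
    × (GraphNotions.GlobalLCAProperty (FinGraph.Edge E) ⇔ GraphNotions.PairwiseLCAProperty (FinGraph.LxtEdge E))
    × (GraphNotions.GlobalLCAProperty (FinGraph.Edge E) ⇔ (GraphNotions.IsClusteringSystem (FinGraph.LxtEdge E) × GraphNotions.IsClosed (FinGraph.LxtEdge E)))
    × (GraphNotions.GlobalLCAProperty (FinGraph.Edge E) ⇔ GraphNotions.IsPreBinary (FinGraph.LxtEdge E))
theorem6p7 n E acyclic =
    mk⇔ (X.pairwiseJoins⇒globalLCA ∘ lxt-joins)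
        (from-pairwiseLCA ∘ X.lca⇒pairwiseLCA ∘ X.globalLCA⇒lca)
  , mk⇔ (X.pairwiseJoins⇒globalPairwiseLCA ∘ lxt-joins)
        (from-pairwiseLCA ∘ X.globalPairwiseLCA⇒pairwiseLCA)
  , mk⇔ (X.globalLCA⇒lca ∘ X.pairwiseJoins⇒globalLCA ∘ lxt-joins)
        (from-pairwiseLCA ∘ X.lca⇒pairwiseLCA)
  , mk⇔ (X.globalPairwiseLCA⇒pairwiseLCA ∘ X.pairwiseJoins⇒globalPairwiseLCA ∘ lxt-joins)
        from-pairwiseLCA
  , mk⇔ (X.pairwiseJoins⇒closedClusteringSystem (inj₁ zero) ∘ lxt-joins)
        (from-pairwiseLCA ∘ uncurry (X.closed⇒pairwiseLCA lxt-clustersFaithful))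
  , mk⇔ (X.pairwiseJoins⇒preBinary (inj₁ zero) ∘ lxt-joins)
        (from-pairwiseLCA ∘ X.preBinary⇒pairwiseLCA lxt-clustersFaithful)
  where
    open LeafExtension E acyclic

    lxt-joins : G.GlobalLCAProperty → X.HasPairwiseJoins
    lxt-joins = joins⇒lxt-joins ∘ G.globalLCA⇒pairwiseJoins

    from-pairwiseLCA : X.PairwiseLCAProperty → G.GlobalLCAProperty
    from-pairwiseLCA = G.pairwiseJoins⇒globalLCA ∘ pairwiseLCA⇒joins
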